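{- Let $G$ be a graph, $X,Y$ disjoint subsets of $V(G)$, and $K_1,K_2$ two minimal $X$–$Y$ separators. Then $NR(G,Y,K_1)\subseteq NR(G,Y,K_2)$ if and only if $K_1\setminus K_2\subseteq NR(G,Y,K_2)$.
   Context: All graphs are finite, simple and undirected; $G\setminus C$ is the subgraph induced by $V(G)\setminus C$. An $X$–$Y$ separator is a set $K\subseteq V(G)\setminus(X\cup Y)$ such that $G\setminus K$ has no path from a vertex of $X$ to a vertex of $Y$; it is minimal if inclusion-minimal. For disjoint $A,B\subseteq V(G)$, $NR(G,A,B)$ is the set of vertices of $G\setminus B$ not reachable from any vertex of $A$ in $G\setminus B$. (In the paper, $NR(G,Y,K_1)\subseteq NR(G,Y,K_2)$ is written $K_1\le K_2$.) -}

module Defs where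

open import Data.Nat using (ℕ)
open import Data.Fin using (Fin)
open import Data.Bool using (Bool; true; false)
open import Data.Fin.Subset using (Subset; _∈_; _∉_; _⊆_; _⊂_; _∩_; _∪_; _─_; Empty)
open import Data.Product using (Σ; _×_; ∃-syntax)
open import Relation.Nullary using (¬_)
open import Relation.Binary.PropositionalEquality using (_≡_)

record Graph (n : ℕ) : Set where
  field
    adj   : Fin n → Fin n → Bool
    sym   : ∀ u v → adj u v ≡ adj v u
    irrefl : ∀ v → adj v v ≡ false
open Graph public

data WalkAvoid {n : ℕ} (G : Graph n) (B : Subset n) : Fin n → Fin n → Set where
  here : ∀ {v} → v ∉ B → WalkAvoid G B v v
  step : ∀ {u w v} → u ∉ B → adj G u w ≡ true → WalkAvoid G B w v → WalkAvoid G B u v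

ReachableFrom : {n : ℕ} → Graph n → Subset n → Subset n → Fin n → Set
ReachableFrom G A B v = ∃[ a ] (a ∈ A × WalkAvoid G B a v)

NR : {n : ℕ} → Graph n → Subset n → Subset n → Fin n → Set
NR G A B v = v ∉ B × ¬ ReachableFrom G A B v

Disjoint : {n : ℕ} → Subset n → Subset n → Set
Disjoint S T = Empty (S ∩ T)

IsSeparator : {n : ℕ} → Graph n → Subset n → Subset n → Subset n → Set
IsSeparator G X Y K =
  Disjoint K (X ∪ Y) ×
  (∀ x y → x ∈ X → y ∈ Y → ¬ WalkAvoid G K x y)

IsMinimalSeparator : {n : ℕ} → Graph n → Subset n → Subset n → Subset n → Set
IsMinimalSeparator G X Y K =
  IsSeparator G X Y K × (∀ K′ → K′ ⊂ K → ¬ IsSeparator G X Y K′)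

module Submission where

open import Defs
open import Data.Nat using (ℕ)
open import Data.Fin.Subset using (Subset; _∈_; _─_)
open import Function.Bundles using (_⇔_)

open import Data.Fin using (Fin; _≟_)
open import Data.Fin.Subset using (_∉_; ⁅_⁆; inside; outside)
open import Data.Fin.Subset.Properties
  using (_∈?_; x∈p∧x∉q⇒x∈p─q; p─q⊆p; p∩q≢∅⇒p─q⊂p; x∈p∩q⁺; x∈p∩q⁻; x∈p∪q⁺; x∈⁅x⁆; x≢y⇒x∉⁅y⁆)
open import Data.Bool using (true)
open import Data.Vec using (_∷_; here; there)
open import Data.Product using (_,_; proj₂; _×_; ∃-syntax)
open import Data.Sum using (_⊎_; inj₁; inj₂)
open import Data.Empty using (⊥-elim)
open import Relation.Nullary using (¬_; yes; no)
open import Relation.Binary.PropositionalEquality using (_≡_; refl; trans)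
open import Function.Bundles using (mk⇔)

-- Write NR₁ = NR(G,Y,K₁), NR₂ = NR(G,Y,K₂) and "Y-reachable" for
-- reachable from Y in G ∖ K₂.  Two facts about a minimal X–Y separator K do
-- all the work: every v ∈ K has a neighbour reachable from X in G ∖ K and a
-- neighbour reachable from Y in G ∖ K (otherwise K ∖ {v} would still separate).
--   (⇒) Let v ∈ K₁ ∖ K₂ be Y-reachable.  Its X-side neighbour u w.r.t. K₁ lies
--   in NR₁ (a Y-walk to u would join X to Y in G ∖ K₁), hence in NR₂; but u is
--   adjacent to the Y-reachable v, so u is Y-reachable — a contradiction.
--   (⇐) If K₁ ∖ K₂ ⊆ NR₂, a walk in G ∖ K₂ from a Y-reachable vertex never
--   meets K₁, since all its vertices are Y-reachable.  So Y-reachability in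
--   G ∖ K₂ implies reachability in G ∖ K₁, and v ∈ NR₁ cannot be Y-reachable;
--   v ∉ K₂ because otherwise v's Y-side neighbour w.r.t. K₂ would make v
--   reachable from Y in G ∖ K₁.
-- Since only ⊥ is ever concluded, the neighbour facts are stated in
-- continuation form, which avoids deciding reachability.

x∈p─q⇒x∉q : ∀ {n} (p q : Subset n) {x : Fin n} → x ∈ p ─ q → x ∉ q
x∈p─q⇒x∉q (_ ∷ p) (inside  ∷ q) ()        here
x∈p─q⇒x∉q (_ ∷ p) (outside ∷ q) (there a) (there b) = x∈p─q⇒x∉q p q a b
x∈p─q⇒x∉q (_ ∷ p) (inside  ∷ q) (there a) (there b) = x∈p─q⇒x∉q p q a b

module _ {n : ℕ} (G : Graph n) where

  start-avoids : ∀ {B s t} → WalkAvoid G B s t → s ∉ B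
  start-avoids (here s∉B)     = s∉B
  start-avoids (step s∉B _ _) = s∉B

  end-avoids : ∀ {B s t} → WalkAvoid G B s t → t ∉ B
  end-avoids (here t∉B)   = t∉B
  end-avoids (step _ _ w) = end-avoids w

  append-edge : ∀ {B s t u} → WalkAvoid G B s t → adj G t u ≡ true → u ∉ B →
                WalkAvoid G B s u
  append-edge (here t∉B)     e u∉B = step t∉B e (here u∉B)
  append-edge (step s∉B e′ w) e u∉B = step s∉B e′ (append-edge w e u∉B)

  reverse : ∀ {B s t} → WalkAvoid G B s t → WalkAvoid G B t s
  reverse (here s∉B) = here s∉B
  reverse (step {s} {w} s∉B e rest) =
    append-edge (reverse rest) (trans (Graph.sym G w s) e) s∉B

  concat : ∀ {B s t u} → WalkAvoid G B s t → WalkAvoid G B t u → WalkAvoid G B s u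
  concat (here _)       w′ = w′
  concat (step s∉B e w) w′ = step s∉B e (concat w w′)

  reach-edge : ∀ {A B v u} → ReachableFrom G A B v → adj G v u ≡ true → u ∉ B →
               ReachableFrom G A B u
  reach-edge (a , a∈A , w) e u∉B = a , a∈A , append-edge w e u∉B

  first-hit : ∀ {K v s t} → v ∈ K → WalkAvoid G (K ─ ⁅ v ⁆) s t → s ∉ K →
              WalkAvoid G K s t ⊎ (∃[ u ] (adj G u v ≡ true × WalkAvoid G K s u))
  first-hit v∈K (here _) s∉K = inj₁ (here s∉K)
  first-hit {K} v∈K (step {w = w} _ e rest) s∉K with w ∈? K
  ... | no w∉K with first-hit v∈K rest w∉K
  ...   | inj₁ walk            = inj₁ (step s∉K e walk)
  ...   | inj₂ (u , e′ , walk) = inj₂ (u , e′ , step s∉K e walk)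
  first-hit {K} {v} v∈K (step {s} {w} _ e rest) s∉K | yes w∈K with w ≟ v
  ...   | yes refl = inj₂ (s , e , here s∉K)
  ...   | no w≢v   = ⊥-elim (start-avoids rest (x∈p∧x∉q⇒x∈p─q w∈K (x≢y⇒x∉⁅y⁆ w≢v)))

  sep-avoids-X : ∀ {X Y K x} → IsSeparator G X Y K → x ∈ X → x ∉ K
  sep-avoids-X (disj , _) x∈X x∈K = disj (_ , x∈p∩q⁺ (x∈K , x∈p∪q⁺ (inj₁ x∈X)))

  sep-avoids-Y : ∀ {X Y K y} → IsSeparator G X Y K → y ∈ Y → y ∉ K
  sep-avoids-Y (disj , _) y∈Y y∈K = disj (_ , x∈p∩q⁺ (y∈K , x∈p∪q⁺ (inj₂ y∈Y)))

  X-side⇒NR : ∀ {X Y K x u} → IsSeparator G X Y K → x ∈ X → WalkAvoid G K x u →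
              NR G Y K u
  X-side⇒NR (_ , separates) x∈X walk =
    end-avoids walk ,
    λ { (y , y∈Y , walk′) → separates _ y x∈X y∈Y (concat walk (reverse walk′)) }

  minimal-leaky : ∀ {X Y K v} → IsMinimalSeparator G X Y K → v ∈ K →
                  ¬ (∀ x y → x ∈ X → y ∈ Y → ¬ WalkAvoid G (K ─ ⁅ v ⁆) x y)
  minimal-leaky {K = K} {v} ((disj , _) , minimal) v∈K separates =
    minimal (K ─ ⁅ v ⁆) (p∩q≢∅⇒p─q⊂p K ⁅ v ⁆ (v , x∈p∩q⁺ (v∈K , x∈⁅x⁆ v)))
            (still-disjoint , separates)
    where
    still-disjoint : Disjoint (K ─ ⁅ v ⁆) _
    still-disjoint (z , z∈) with x∈p∩q⁻ _ _ z∈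
    ... | z∈K─v , z∈X∪Y = disj (z , x∈p∩q⁺ (p─q⊆p K ⁅ v ⁆ z∈K─v , z∈X∪Y))

  X-neighbour : ∀ {X Y K v} → IsMinimalSeparator G X Y K → v ∈ K →
                ¬ (∀ x u → x ∈ X → adj G u v ≡ true → ¬ WalkAvoid G K x u)
  X-neighbour {X} {Y} {K} {v} m@(sep , _) v∈K no-neighbour = minimal-leaky m v∈K separates
    where
    separates : ∀ x y → x ∈ X → y ∈ Y → ¬ WalkAvoid G (K ─ ⁅ v ⁆) x y
    separates x y x∈X y∈Y walk with first-hit v∈K walk (sep-avoids-X sep x∈X)
    ... | inj₁ walk′           = proj₂ sep x y x∈X y∈Y walk′
    ... | inj₂ (u , e , walk′) = no-neighbour x u x∈X e walk′

  Y-neighbour : ∀ {X Y K v} → IsMinimalSeparator G X Y K → v ∈ K →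
                ¬ (∀ y u → y ∈ Y → adj G u v ≡ true → ¬ WalkAvoid G K y u)
  Y-neighbour {X} {Y} {K} {v} m@(sep , _) v∈K no-neighbour = minimal-leaky m v∈K separates
    where
    separates : ∀ x y → x ∈ X → y ∈ Y → ¬ WalkAvoid G (K ─ ⁅ v ⁆) x y
    separates x y x∈X y∈Y walk with first-hit v∈K (reverse walk) (sep-avoids-Y sep y∈Y)
    ... | inj₁ walk′           = proj₂ sep x y x∈X y∈Y (reverse walk′)
    ... | inj₂ (u , e , walk′) = no-neighbour y u y∈Y e walk′

  NR-mono⇒difference⊆NR : ∀ {X Y K₁ K₂} → IsMinimalSeparator G X Y K₁ →
    (∀ v → NR G Y K₁ v → NR G Y K₂ v) → ∀ v → v ∈ K₁ ─ K₂ → NR G Y K₂ v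
  NR-mono⇒difference⊆NR {X} {Y} {K₁} {K₂} m₁@(sep₁ , _) mono v v∈K₁─K₂ =
    v∉K₂ , λ reach → X-neighbour m₁ v∈K₁ (neighbour-unreachable reach)
    where
    v∈K₁ = p─q⊆p K₁ K₂ v∈K₁─K₂
    v∉K₂ = x∈p─q⇒x∉q K₁ K₂ v∈K₁─K₂
    -- an X-side neighbour u of v is in NR₁ ⊆ NR₂, yet adjacent to Y-reachable v
    neighbour-unreachable : ReachableFrom G Y K₂ v →
      ∀ x u → x ∈ X → adj G u v ≡ true → ¬ WalkAvoid G K₁ x u
    neighbour-unreachable reach x u x∈X e walk with mono u (X-side⇒NR sep₁ x∈X walk)
    ... | u∉K₂ , u-unreachable =
      u-unreachable (reach-edge reach (trans (Graph.sym G v u) e) u∉K₂)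

  -- If K₁ ∖ K₂ ⊆ NR(G,Y,K₂), walks in G ∖ K₂ that start Y-reachable avoid K₁:
  -- each vertex on them is Y-reachable in G ∖ K₂, so it cannot lie in K₁ ∖ K₂.
  Y-walk-avoids : ∀ {Y K₁ K₂ s t} → (∀ v → v ∈ K₁ ─ K₂ → NR G Y K₂ v) →
    ReachableFrom G Y K₂ s → WalkAvoid G K₂ s t → WalkAvoid G K₁ s t
  Y-walk-avoids {K₁ = K₁} {s = s} diff⊆NR reach walk with s ∈? K₁
  ... | yes s∈K₁ = ⊥-elim (proj₂ (diff⊆NR s (x∈p∧x∉q⇒x∈p─q s∈K₁ (start-avoids walk))) reach)
  Y-walk-avoids diff⊆NR reach (here _)       | no s∉K₁ = here s∉K₁
  Y-walk-avoids diff⊆NR reach (step _ e walk) | no s∉K₁ =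
    step s∉K₁ e (Y-walk-avoids diff⊆NR (reach-edge reach e (start-avoids walk)) walk)

  Y-reach-transfer : ∀ {Y K₁ K₂ v} → (∀ v → v ∈ K₁ ─ K₂ → NR G Y K₂ v) →
    ReachableFrom G Y K₂ v → ReachableFrom G Y K₁ v
  Y-reach-transfer diff⊆NR (y , y∈Y , walk) =
    y , y∈Y , Y-walk-avoids diff⊆NR (y , y∈Y , here (start-avoids walk)) walk

  difference⊆NR⇒NR-mono : ∀ {X Y K₁ K₂} → IsMinimalSeparator G X Y K₂ →
    (∀ v → v ∈ K₁ ─ K₂ → NR G Y K₂ v) → ∀ v → NR G Y K₁ v → NR G Y K₂ v
  difference⊆NR⇒NR-mono {X} {Y} {K₁} {K₂} m₂@(sep₂ , _) diff⊆NR v (v∉K₁ , v-unreachable) =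
    v∉K₂ , λ reach → v-unreachable (Y-reach-transfer diff⊆NR reach)
    where
    -- were v ∈ K₂, its Y-side neighbour would make v Y-reachable in G ∖ K₁
    v∉K₂ : v ∉ K₂
    v∉K₂ v∈K₂ = Y-neighbour m₂ v∈K₂ λ y u y∈Y e walk →
      v-unreachable (reach-edge (Y-reach-transfer diff⊆NR (y , y∈Y , walk)) e v∉K₁)

-- The two directions combined.
proposition1 : {n : ℕ} (G : Graph n) (X Y K₁ K₂ : Subset n) →
    Disjoint X Y →
    IsMinimalSeparator G X Y K₁ →
    IsMinimalSeparator G X Y K₂ →
    ((∀ v → NR G Y K₁ v → NR G Y K₂ v) ⇔ (∀ v → v ∈ (K₁ ─ K₂) → NR G Y K₂ v))
proposition1 G X Y K₁ K₂ _ m₁ m₂ =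
  mk⇔ (NR-mono⇒difference⊆NR G m₁) (difference⊆NR⇒NR-mono G m₂)
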